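{- Let $l\geqslant 1$ and $n\geqslant l+2$ be integers. Then $\kappa_l(n,2)=\left\lfloor\dfrac{n+l}{2}\right\rfloor$.
   Context: For a positive integer $n$, $[n]=\{1,\ldots,n\}$. A family $\mathcal{F}$ of subsets of $[n]$ is an $m$-family if it has $m$ members (required to be pairwise distinct subsets); it is $k$-uniform if every member has size $k$; for a set $L$ of nonnegative integers it is $L$-intersecting if $|F\cap F'|\in L$ for every two distinct members $F,F'$. $\kappa_{L}(n,m)$ denotes the maximum $k$ such that there exists a $k$-uniform $L$-intersecting $m$-family of subsets of $[n]$ (and $-\infty$ if none exists), and $\kappa_l(n,m)$ denotes $\kappa_{\{l\}}(n,m)$. -}

module Defs where

open import Data.Nat using (ℕ; _≤_)
open import Data.Fin using (Fin)
open import Data.Fin.Subset using (Subset; ∣_∣; _∩_)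
open import Data.Product using (Σ; _×_)
open import Relation.Binary.PropositionalEquality using (_≡_; _≢_)

-- A subset of [n] = {1,…,n} is represented as a 'Subset n' (characteristic
-- vector over Fin n).  An m-family is an indexed family Fin m → Subset n whose
-- members are pairwise distinct.

PairwiseDistinct : {n m : ℕ} → (Fin m → Subset n) → Set
PairwiseDistinct {n} {m} F = (i j : Fin m) → i ≢ j → F i ≢ F j

Uniform : {n m : ℕ} → ℕ → (Fin m → Subset n) → Set
Uniform {n} {m} k F = (i : Fin m) → ∣ F i ∣ ≡ k

LIntersecting : {n m : ℕ} → (ℕ → Set) → (Fin m → Subset n) → Set
LIntersecting {n} {m} L F = (i j : Fin m) → i ≢ j → L ∣ F i ∩ F j ∣

Realizable : (ℕ → Set) → ℕ → ℕ → ℕ → Set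
Realizable L n m k =
  Σ (Fin m → Subset n) (λ F → PairwiseDistinct F × Uniform k F × LIntersecting L F)

KappaIs : (ℕ → Set) → ℕ → ℕ → ℕ → Set
KappaIs L n m k = Realizable L n m k × ((k' : ℕ) → Realizable L n m k' → k' ≤ k)

Singleton : ℕ → ℕ → Set
Singleton l x = x ≡ l

module Submission where

-- For any two subsets p, q of [n], inclusion–exclusion gives
-- ∣p∣ + ∣q∣ = ∣p ∪ q∣ + ∣p ∩ q∣ ≤ n + ∣p ∩ q∣.  Hence if both members of a
-- 2-family have size k and meet in exactly l points, 2k ≤ n + l, i.e.
-- k ≤ ⌊(n+l)/2⌋.
--
-- Splitting [n] into blocks of sizes c, a, b, r, the sets
-- p = C ∪ A and q = C ∪ B have sizes c + a, c + b and meet in c points.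
-- With c = l, a = b = d and d + d + l ≤ n this is an l-intersecting
-- (d + l)-uniform pair, distinct as soon as d ≥ 1.  For k = ⌊(n+l)/2⌋ the
-- choice d = k - l works: n ≥ l + 2 forces k ≥ l + 1, and 2k ≤ n + l
-- forces d + d + l ≤ n.  (The argument does not need the hypothesis l ≥ 1.)

open import Defs
open import Data.Nat using (ℕ; zero; suc; _+_; _*_; _∸_; _≤_; _<_; _/_; NonZero)
open import Data.Nat.Properties
open import Data.Nat.DivMod using (m/n*n≤m; m*n/n≡m; /-monoˡ-≤)
open import Data.Bool using (true; false)
open import Data.Vec using ([]; _∷_)
open import Data.Fin using (Fin; zero; suc)
open import Data.Fin.Subset using (Subset; ∣_∣; _∩_; _∪_)
open import Data.Fin.Subset.Properties using (∣p∣≤n; ∩-comm; ∩-idem)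
open import Data.Product using (Σ; _×_; _,_)
open import Data.Empty using (⊥-elim)
open import Function using (_∘_)
open import Relation.Binary.PropositionalEquality

∣p∣+∣q∣≡∣p∪q∣+∣p∩q∣ : ∀ {n} (p q : Subset n) → ∣ p ∣ + ∣ q ∣ ≡ ∣ p ∪ q ∣ + ∣ p ∩ q ∣
∣p∣+∣q∣≡∣p∪q∣+∣p∩q∣ [] [] = refl
∣p∣+∣q∣≡∣p∪q∣+∣p∩q∣ (true ∷ p) (true ∷ q) = begin
  suc (∣ p ∣ + suc ∣ q ∣)       ≡⟨ cong suc (+-suc ∣ p ∣ ∣ q ∣) ⟩
  suc (suc (∣ p ∣ + ∣ q ∣))     ≡⟨ cong (2 +_) (∣p∣+∣q∣≡∣p∪q∣+∣p∩q∣ p q) ⟩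
  suc (suc (∣ p ∪ q ∣ + ∣ p ∩ q ∣)) ≡⟨ cong suc (+-suc ∣ p ∪ q ∣ ∣ p ∩ q ∣) ⟨
  suc (∣ p ∪ q ∣ + suc ∣ p ∩ q ∣) ∎
  where open ≡-Reasoning
∣p∣+∣q∣≡∣p∪q∣+∣p∩q∣ (true ∷ p) (false ∷ q) = cong suc (∣p∣+∣q∣≡∣p∪q∣+∣p∩q∣ p q)
∣p∣+∣q∣≡∣p∪q∣+∣p∩q∣ (false ∷ p) (true ∷ q) =
  trans (+-suc ∣ p ∣ ∣ q ∣) (cong suc (∣p∣+∣q∣≡∣p∪q∣+∣p∩q∣ p q))
∣p∣+∣q∣≡∣p∪q∣+∣p∩q∣ (false ∷ p) (false ∷ q) = ∣p∣+∣q∣≡∣p∪q∣+∣p∩q∣ p q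

∣p∣+∣q∣≤n+∣p∩q∣ : ∀ {n} (p q : Subset n) → ∣ p ∣ + ∣ q ∣ ≤ n + ∣ p ∩ q ∣
∣p∣+∣q∣≤n+∣p∩q∣ {n} p q =
  subst (_≤ n + ∣ p ∩ q ∣) (sym (∣p∣+∣q∣≡∣p∪q∣+∣p∩q∣ p q)) (+-monoˡ-≤ ∣ p ∩ q ∣ (∣p∣≤n (p ∪ q)))

≤-/ : ∀ k m d .{{_ : NonZero d}} → k * d ≤ m → k ≤ m / d
≤-/ k m d k*d≤m = subst (_≤ m / d) (m*n/n≡m k d) (/-monoˡ-≤ d k*d≤m)

uniform-pair-bound : ∀ {n m k l} (F : Fin m → Subset n) → Uniform k F →
  LIntersecting (Singleton l) F → (i j : Fin m) → i ≢ j → k * 2 ≤ n + l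
uniform-pair-bound {n} {k = k} {l} F uniform intersecting i j i≢j =
  subst₂ _≤_ sizes meet (∣p∣+∣q∣≤n+∣p∩q∣ (F i) (F j))
  where
  sizes : ∣ F i ∣ + ∣ F j ∣ ≡ k * 2
  sizes = trans (cong₂ _+_ (uniform i) (uniform j)) (trans (cong (k +_) (sym (+-identityʳ k))) (*-comm 2 k))
  meet : n + ∣ F i ∩ F j ∣ ≡ n + l
  meet = cong (n +_) (intersecting i j i≢j)

SizedPair : ℕ → ℕ → ℕ → ℕ → Set
SizedPair n a b c =
  Σ (Subset n) λ p → Σ (Subset n) λ q → ∣ p ∣ ≡ a × ∣ q ∣ ≡ b × ∣ p ∩ q ∣ ≡ c

-- Blocks of c common points, a points of p only, b points of q only and
-- r points outside both realize the sizes (a + c, b + c; overlap c).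
-- Points are added one at a time, the last block first.
block-pair : ∀ c a b r → SizedPair (r + (b + (a + c))) (a + c) (b + c) c
block-pair zero zero zero zero = [] , [] , refl , refl , refl
block-pair (suc c) zero zero zero with block-pair c 0 0 0
... | p , q , ∣p∣ , ∣q∣ , ∣p∩q∣ = true ∷ p , true ∷ q , cong suc ∣p∣ , cong suc ∣q∣ , cong suc ∣p∩q∣
block-pair c (suc a) zero zero with block-pair c a 0 0
... | p , q , ∣p∣ , ∣q∣ , ∣p∩q∣ = true ∷ p , false ∷ q , cong suc ∣p∣ , ∣q∣ , ∣p∩q∣
block-pair c a (suc b) zero with block-pair c a b 0
... | p , q , ∣p∣ , ∣q∣ , ∣p∩q∣ = false ∷ p , true ∷ q , ∣p∣ , cong suc ∣q∣ , ∣p∩q∣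
block-pair c a b (suc r) with block-pair c a b r
... | p , q , ∣p∣ , ∣q∣ , ∣p∩q∣ = false ∷ p , false ∷ q , ∣p∣ , ∣q∣ , ∣p∩q∣

small-overlap⇒≢ : ∀ {n} (p q : Subset n) → ∣ p ∩ q ∣ < ∣ p ∣ → p ≢ q
small-overlap⇒≢ p q overlap<size refl = <-irrefl (cong ∣_∣ (∩-idem p)) overlap<size

pair-realizable : ∀ {L n k} (p q : Subset n) → p ≢ q → ∣ p ∣ ≡ k → ∣ q ∣ ≡ k →
  L ∣ p ∩ q ∣ → Realizable L n 2 k
pair-realizable {L} p q p≢q ∣p∣ ∣q∣ Lpq = F , distinct , uniform , intersecting
  where
  F : Fin 2 → Subset _
  F zero = p
  F (suc zero) = q
  distinct : PairwiseDistinct F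
  distinct zero zero 0≢0 = ⊥-elim (0≢0 refl)
  distinct zero (suc zero) _ = p≢q
  distinct (suc zero) zero _ = p≢q ∘ sym
  distinct (suc zero) (suc zero) 1≢1 = ⊥-elim (1≢1 refl)
  uniform : Uniform _ F
  uniform zero = ∣p∣
  uniform (suc zero) = ∣q∣
  intersecting : LIntersecting L F
  intersecting zero zero 0≢0 = ⊥-elim (0≢0 refl)
  intersecting zero (suc zero) _ = Lpq
  intersecting (suc zero) zero _ = subst (λ s → L ∣ s ∣) (∩-comm p q) Lpq
  intersecting (suc zero) (suc zero) 1≢1 = ⊥-elim (1≢1 refl)

block-realizable : ∀ l d n → 1 ≤ d → d + (d + l) ≤ n → Realizable (Singleton l) n 2 (d + l)
block-realizable l d n d≥1 fits with block-pair l d d (n ∸ (d + (d + l)))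
... | p , q , ∣p∣ , ∣q∣ , ∣p∩q∣ rewrite m∸n+n≡m fits =
  pair-realizable {L = Singleton l} p q (small-overlap⇒≢ p q overlap<size) ∣p∣ ∣q∣ ∣p∩q∣
  where
  overlap<size : ∣ p ∩ q ∣ < ∣ p ∣
  overlap<size = subst₂ _<_ (sym ∣p∩q∣) (sym ∣p∣) (m<n+m l d≥1)

half-realizable : ∀ l n → l + 2 ≤ n → Realizable (Singleton l) n 2 ((n + l) / 2)
half-realizable l n l+2≤n = subst (Realizable (Singleton l) n 2) d+l≡k
  (block-realizable l d n (m<n⇒0<n∸m l<k) fits)
  where
  k = (n + l) / 2
  d = k ∸ l
  l<k : l < k
  l<k = ≤-/ (suc l) (n + l) 2 (begin
    suc l * 2     ≡⟨ *-comm (suc l) 2 ⟩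
    2 * suc l     ≡⟨ cong suc (+-suc l (l + 0)) ⟩
    suc (suc l) + (l + 0) ≡⟨ cong (λ x → suc (suc l) + x) (+-identityʳ l) ⟩
    suc (suc l) + l       ≤⟨ +-monoˡ-≤ l (subst (_≤ n) (+-comm l 2) l+2≤n) ⟩
    n + l ∎)
    where open ≤-Reasoning
  d+l≡k : d + l ≡ k
  d+l≡k = m∸n+n≡m (<⇒≤ l<k)
  fits : d + (d + l) ≤ n
  fits = +-cancelʳ-≤ l _ _ (begin
    d + (d + l) + l ≡⟨ +-comm (d + (d + l)) l ⟩
    l + (d + (d + l)) ≡⟨ +-assoc l d (d + l) ⟨
    (l + d) + (d + l) ≡⟨ cong₂ _+_ (trans (+-comm l d) d+l≡k) d+l≡k ⟩
    k + k           ≡⟨ cong (k +_) (+-identityʳ k) ⟨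
    2 * k           ≡⟨ *-comm 2 k ⟩
    k * 2           ≤⟨ m/n*n≤m (n + l) 2 ⟩
    n + l ∎)
    where open ≤-Reasoning

theorem2p2 : (l n : ℕ) → 1 ≤ l → l + 2 ≤ n →
    KappaIs (Singleton l) n 2 ((n + l) / 2)
theorem2p2 l n _ l+2≤n = half-realizable l n l+2≤n , maximal
  where
  maximal : (k : ℕ) → Realizable (Singleton l) n 2 k → k ≤ (n + l) / 2
  maximal k (F , _ , uniform , intersecting) =
    ≤-/ k (n + l) 2 (uniform-pair-bound {l = l} F uniform intersecting zero (suc zero) λ ())
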